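{- Let $u=u_0u_1u_2\cdots$ be a recurrent infinite word over a finite alphabet $\mathcal A$ and let $m\in\mathbb N$. Suppose that for every $n\in\mathbb N$ at least one of the following two conditions holds: (i) there is a unique left special factor $w$ of $u$ of length $n$, and $\#\mathcal E_\ell(w)=m$; (ii) there is a unique right special factor $w$ of $u$ of length $n$, and $\#\mathcal E_r(w)=m$. Then $u$ has property $R_m$, i.e., every factor of $u$ has exactly $m$ return words.
   Context: A factor of $u$ is a finite (possibly empty) word $w$ with $u_ju_{j+1}\cdots u_{j+|w|-1}=w$ for some $j\ge 0$; such $j$ is an occurrence of $w$. The word $u$ is recurrent if every factor occurs infinitely often. For a factor $w$, $\mathcal E_\ell(w)=\{a\in\mathcal A: aw \text{ is a factor}\}$ and $\mathcal E_r(w)=\{b\in\mathcal A: wb\text{ is a factor}\}$; $w$ is left special if $\#\mathcal E_\ell(w)\ge2$ and right special if $\#\mathcal E_r(w)\ge2$. If $j<k$ are successive occurrences of $w$ in $u$, the word $u_ju_{j+1}\cdots u_{k-1}$ is a return word of $w$; $\mathcal R(w)$ denotes the set of all return words of $w$. The word $u$ has property $R_m$ if $\#\mathcal R(w)=m$ for every factor $w$ (including the empty word). -}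

module Defs where

open import Data.Nat using (ℕ; _+_; _<_; _≥_)
open import Data.Fin using (Fin)
open import Data.List using (List; []; _∷_; length; lookup)
open import Data.List.Membership.Propositional using (_∈_)
open import Data.List.Relation.Unary.Unique.Propositional using (Unique)
open import Data.Product using (Σ; ∃; _×_; _,_)
open import Relation.Binary.PropositionalEquality using (_≡_; _≢_)
open import Relation.Nullary using (¬_)
open import Function.Bundles using (_⇔_)

Word : ℕ → Set
Word k = ℕ → Fin k

Occ : ∀ {k} → Word k → List (Fin k) → ℕ → Set
Occ u w j = ∀ (i : Fin (length w)) → u (j + Data.Fin.toℕ i) ≡ lookup w i

IsFactor : ∀ {k} → Word k → List (Fin k) → Set
IsFactor u w = ∃ λ j → Occ u w j

Recurrent : ∀ {k} → Word k → Set
Recurrent u = ∀ w → IsFactor u w → ∀ (N : ℕ) → ∃ λ j → j ≥ N × Occ u w j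

HasCard : ∀ {A : Set} → (A → Set) → ℕ → Set
HasCard {A} P m = Σ (List A) λ xs → Unique xs × length xs ≡ m × (∀ x → (x ∈ xs) ⇔ P x)

Eℓ : ∀ {k} → Word k → List (Fin k) → Fin k → Set
Eℓ u w a = IsFactor u (a ∷ w)

Er : ∀ {k} → Word k → List (Fin k) → Fin k → Set
Er u w b = IsFactor u (w Data.List.++ (b ∷ []))

LeftSpecial : ∀ {k} → Word k → List (Fin k) → Set
LeftSpecial u w = ∃ λ a → ∃ λ b → a ≢ b × Eℓ u w a × Eℓ u w b

RightSpecial : ∀ {k} → Word k → List (Fin k) → Set
RightSpecial u w = ∃ λ a → ∃ λ b → a ≢ b × Er u w a × Er u w b

slice : ∀ {k} → Word k → ℕ → ℕ → List (Fin k)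
slice u j ℕ.zero = []
slice u j (ℕ.suc len) = u j ∷ slice u (ℕ.suc j) len

Successive : ∀ {k} → Word k → List (Fin k) → ℕ → ℕ → Set
Successive u w j l = j < l × Occ u w j × Occ u w l × (∀ i → j < i → i < l → ¬ Occ u w i)

IsReturnWord : ∀ {k} → Word k → List (Fin k) → List (Fin k) → Set
IsReturnWord u w r = ∃ λ j → ∃ λ l → Successive u w j l × r ≡ slice u j (l Data.Nat.∸ j)

-- Property R_m: every factor (including the empty word) has exactly m return words.
PropertyR : ∀ {k} → Word k → ℕ → Set
PropertyR u m = ∀ w → IsFactor u w → HasCard (IsReturnWord u w) m

CondLeft : ∀ {k} → Word k → ℕ → ℕ → Set
CondLeft u m n = ∃ λ w → length w ≡ n × IsFactor u w × LeftSpecial u w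
  × (∀ w' → length w' ≡ n → IsFactor u w' → LeftSpecial u w' → w' ≡ w)
  × HasCard (Eℓ u w) m

CondRight : ∀ {k} → Word k → ℕ → ℕ → Set
CondRight u m n = ∃ λ w → length w ≡ n × IsFactor u w × RightSpecial u w
  × (∀ w' → length w' ≡ n → IsFactor u w' → RightSpecial u w' → w' ≡ w)
  × HasCard (Er u w) m

-- Fix a factor w and a distance d > 0 at which it recurs, and grow w one letter at a time. If the
-- current word v of length n is not the special factor that the hypothesis provides for n, then v is
-- not special on the side the hypothesis refers to, so all its occurrences extend by the same letter
-- on that side. This keeps the occurrences, hence the return words: unchanged for a right extension,
-- conjugated (a x ↦ x a) for a left one. The growth stops before |v| reaches |w| + 2d, for otherwise
-- occurrences of v propagate by d and u is eventually d-periodic, which leaves no special factor of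
-- length d. It stops at the unique left (right) special factor v of its length, whose return words
-- correspond to its m left (right) extensions: a return word is determined by the letter before the
-- next occurrence of v (after v), since every other factor of length |v| extends uniquely.

module Submission where

open import Data.Empty using (⊥-elim)
open import Data.Fin as Fin using (Fin; toℕ)
open import Data.List using (List; []; _∷_; _++_; _∷ʳ_; length)
open import Data.List.Membership.Propositional using (_∈_)
open import Data.List.Properties
  using (≡-dec; ∷-injective; ∷-injectiveˡ; ∷-injectiveʳ; ∷ʳ-injective; ∷ʳ-injectiveˡ; length-++)
open import Data.List.Relation.Binary.Pointwise using (Pointwise; []; _∷_; Pointwise-length)
open import Data.List.Relation.Unary.All using (All; []; _∷_)
open import Data.List.Relation.Unary.AllPairs using ([]; _∷_)
open import Data.List.Relation.Unary.Any using (here; there)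
open import Data.List.Relation.Unary.Unique.Propositional using (Unique)
open import Data.Nat
open import Data.Nat.Induction using (<-rec)
open import Data.Nat.Properties
open import Algebra.Properties.CommutativeSemigroup +-commutativeSemigroup using (xy∙z≈xz∙y)
open import Data.Product using (∃; ∃₂; _×_; _,_; proj₁; proj₂)
open import Data.Sum using (_⊎_; inj₁; inj₂)
open import Function using (_∘_)
open import Function.Bundles using (_⇔_; mk⇔; Equivalence)
open import Function.Properties.Equivalence using () renaming (sym to ⇔-sym; trans to ⇔-trans)
open import Relation.Binary.PropositionalEquality
open import Relation.Nullary using (¬_; Dec; yes; no; _×-dec_)
open import Relation.Nullary.Decidable using (decidable-stable)

open import Defs

open Equivalence using (to; from)

length-∷ʳ : ∀ {A : Set} (xs : List A) x → length (xs ∷ʳ x) ≡ suc (length xs)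
length-∷ʳ xs _ = trans (length-++ xs) (+-comm (length xs) 1)

module _ {A B : Set} {P : A → Set} {Q : B → Set} (R : A → B → Set)
         (image : ∀ a → P a → ∃ λ b → Q b × R a b)
         (preimage : ∀ b → Q b → ∃ λ a → P a × R a b)
         (functional : ∀ {a b b′} → R a b → R a b′ → b ≡ b′)
         (injective : ∀ {a a′ b} → R a b → R a′ b → a ≡ a′) where

  private
    image-list : ∀ xs → (∀ {a} → a ∈ xs → P a) → ∃ λ ys → Pointwise R xs ys
    image-list [] _ = [] , []
    image-list (x ∷ xs) P-xs with image x (P-xs (here refl)) | image-list xs (P-xs ∘ there)
    ... | y , _ , r | ys , rs = y ∷ ys , r ∷ rs

    Pointwise-distinct : ∀ {x y xs ys} → R x y → Pointwise R xs ys
                       → All (x ≢_) xs → All (y ≢_) ys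
    Pointwise-distinct r [] [] = []
    Pointwise-distinct r (r′ ∷ rs) (x≢x′ ∷ x≢xs) =
      (λ { refl → x≢x′ (injective r r′) }) ∷ Pointwise-distinct r rs x≢xs

    Pointwise-Unique : ∀ {xs ys} → Pointwise R xs ys → Unique xs → Unique ys
    Pointwise-Unique [] [] = []
    Pointwise-Unique (r ∷ rs) (x∉xs ∷ xs!) = Pointwise-distinct r rs x∉xs ∷ Pointwise-Unique rs xs!

    Pointwise-∈ : ∀ {a xs ys} → Pointwise R xs ys → a ∈ xs → ∃ λ b → b ∈ ys × R a b
    Pointwise-∈ (r ∷ _) (here refl) = _ , here refl , r
    Pointwise-∈ (_ ∷ rs) (there a∈xs) with Pointwise-∈ rs a∈xs
    ... | b , b∈ys , r = b , there b∈ys , r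

    Pointwise-∈⁻ : ∀ {b xs ys} → Pointwise R xs ys → b ∈ ys → ∃ λ a → a ∈ xs × R a b
    Pointwise-∈⁻ (r ∷ _) (here refl) = _ , here refl , r
    Pointwise-∈⁻ (_ ∷ rs) (there b∈ys) with Pointwise-∈⁻ rs b∈ys
    ... | a , a∈xs , r = a , there a∈xs , r

  HasCard-map : ∀ {m} → HasCard P m → HasCard Q m
  HasCard-map (xs , xs! , |xs| , xs⇔P) with image-list xs (to (xs⇔P _))
  ... | ys , rs = ys , Pointwise-Unique rs xs! , trans (sym (Pointwise-length rs)) |xs|
                , λ b → mk⇔ (∈⇒Q b) (Q⇒∈ b)
    where
    ∈⇒Q : ∀ b → b ∈ ys → Q b
    ∈⇒Q b b∈ys with Pointwise-∈⁻ rs b∈ys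
    ... | a , a∈xs , r with image a (to (xs⇔P a) a∈xs)
    ... | b′ , Qb′ , r′ = subst Q (functional r′ r) Qb′

    Q⇒∈ : ∀ b → Q b → b ∈ ys
    Q⇒∈ b Qb with preimage b Qb
    ... | a , Pa , r with Pointwise-∈ rs (from (xs⇔P a) Pa)
    ... | b′ , b′∈ys , r′ = subst (_∈ ys) (functional r′ r) b′∈ys

HasCard-cong : ∀ {A : Set} {P Q : A → Set} {m} → (∀ a → P a ⇔ Q a) → HasCard P m → HasCard Q m
HasCard-cong P⇔Q (xs , xs! , |xs| , xs⇔P) =
  xs , xs! , |xs| , λ a → mk⇔ (to (P⇔Q a) ∘ to (xs⇔P a)) (from (xs⇔P a) ∘ from (P⇔Q a))

module _ {P : ℕ → Set} (P? : ∀ n → Dec (P n)) where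

  least-witness : ∀ {n} → P n → ∃ λ l → P l × (∀ i → i < l → ¬ P i)
  least-witness {n} = <-rec (λ n → P n → ∃ λ l → P l × (∀ i → i < l → ¬ P i)) step n
    where
    step : ∀ n → (∀ {i} → i < n → P i → ∃ λ l → P l × (∀ i → i < l → ¬ P i))
         → P n → ∃ λ l → P l × (∀ i → i < l → ¬ P i)
    step n smaller Pn with anyUpTo? P? n
    ... | yes (i , i<n , Pi) = smaller i<n Pi
    ... | no none = n , Pn , λ i i<n Pi → none (i , i<n , Pi)

  last-before : ∀ {j} → P j → ∀ q → j < q
              → ∃ λ l → j ≤ l × l < q × P l × (∀ i → l < i → i < q → ¬ P i)
  last-before {j} Pj (suc q) (s≤s j≤q) with P? q
  ... | yes Pq = q , j≤q , ≤-refl , Pq , λ i q<i i<1+q _ → <⇒≱ q<i (≤-pred i<1+q)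
  ... | no ¬Pq with last-before Pj q (≤∧≢⇒< j≤q λ { refl → ¬Pq Pj })
  ...   | l , j≤l , l<q , Pl , gap = l , j≤l , m≤n⇒m≤1+n l<q , Pl , gap′
    where
    gap′ : ∀ i → l < i → i < suc q → ¬ P i
    gap′ i l<i (s≤s i≤q) with m≤n⇒m<n∨m≡n i≤q
    ... | inj₁ i<q = gap i l<i i<q
    ... | inj₂ refl = ¬Pq

module _ {k : ℕ} (u : Word k) where

  length-slice : ∀ j L → length (slice u j L) ≡ L
  length-slice j zero = refl
  length-slice j (suc L) = cong suc (length-slice (suc j) L)

  slice-+ : ∀ j a b → slice u j (a + b) ≡ slice u j a ++ slice u (j + a) b
  slice-+ j zero b = cong (λ i → slice u i b) (sym (+-identityʳ j))
  slice-+ j (suc a) b = cong (u j ∷_) (begin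
    slice u (suc j) (a + b)                   ≡⟨ slice-+ (suc j) a b ⟩
    slice u (suc j) a ++ slice u (suc j + a) b ≡⟨ cong (λ i → slice u (suc j) a ++ slice u i b) (+-suc j a) ⟨
    slice u (suc j) a ++ slice u (j + suc a) b ∎)
    where open ≡-Reasoning

  slice-≡-prefix : ∀ {i j K} b → b ≤ K → slice u i K ≡ slice u j K → slice u i b ≡ slice u j b
  slice-≡-prefix zero _ _ = refl
  slice-≡-prefix (suc b) (s≤s b≤K) eq =
    cong₂ _∷_ (∷-injectiveˡ eq) (slice-≡-prefix b b≤K (∷-injectiveʳ eq))

  slice-≡-drop : ∀ {i j} a {b} → slice u i (a + b) ≡ slice u j (a + b)
               → slice u (i + a) b ≡ slice u (j + a) b
  slice-≡-drop {i} {j} zero eq rewrite +-identityʳ i | +-identityʳ j = eq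
  slice-≡-drop {i} {j} (suc a) eq rewrite +-suc i a | +-suc j a = slice-≡-drop a (∷-injectiveʳ eq)

  slice-≡-infix : ∀ {i j K} a b → a + b ≤ K → slice u i K ≡ slice u j K
                → slice u (i + a) b ≡ slice u (j + a) b
  slice-≡-infix a b a+b≤K = slice-≡-drop a ∘ slice-≡-prefix (a + b) a+b≤K

  slice-≡-letter : ∀ {i j K} t → t < K → slice u i K ≡ slice u j K → u (i + t) ≡ u (j + t)
  slice-≡-letter {K = K} t t<K = ∷-injectiveˡ ∘ slice-≡-infix t 1 (subst (_≤ K) (+-comm 1 t) t<K)

  slice-≡-++ : ∀ {i j} a b → slice u i a ≡ slice u j a → slice u (i + a) b ≡ slice u (j + a) b
             → slice u i (a + b) ≡ slice u j (a + b)
  slice-≡-++ {i} {j} a b eq₁ eq₂ =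
    trans (slice-+ i a b) (trans (cong₂ _++_ eq₁ eq₂) (sym (slice-+ j a b)))

  Occurs : List (Fin k) → ℕ → Set
  Occurs w j = slice u j (length w) ≡ w

  Occurs? : ∀ w j → Dec (Occurs w j)
  Occurs? w j = ≡-dec Fin._≟_ (slice u j (length w)) w

  Occurs-slice : ∀ j L → Occurs (slice u j L) j
  Occurs-slice j L = cong (slice u j) (length-slice j L)

  slice-≡⇒Occurs : ∀ {i j L} → slice u i L ≡ slice u j L → Occurs (slice u i L) j
  slice-≡⇒Occurs {i} {j} {L} eq = trans (cong (slice u j) (length-slice i L)) (sym eq)

  Occurs-slice⇒≡ : ∀ {i j K} → Occurs (slice u i K) j → slice u i K ≡ slice u j K
  Occurs-slice⇒≡ {i} {j} {K} occ = sym (trans (cong (slice u j) (sym (length-slice i K))) occ)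

  Occ⇒Occurs : ∀ {w j} → Occ u w j → Occurs w j
  Occ⇒Occurs {[]} _ = refl
  Occ⇒Occurs {a ∷ w} {j} occ = cong₂ _∷_ (trans (cong u (sym (+-identityʳ j))) (occ Fin.zero))
    (Occ⇒Occurs λ i → trans (cong u (sym (+-suc j (toℕ i)))) (occ (Fin.suc i)))

  Occurs⇒Occ : ∀ {w j} → Occurs w j → Occ u w j
  Occurs⇒Occ {a ∷ w} {j} occ Fin.zero = trans (cong u (+-identityʳ j)) (∷-injectiveˡ occ)
  Occurs⇒Occ {a ∷ w} {j} occ (Fin.suc i) =
    trans (cong u (+-suc j (toℕ i))) (Occurs⇒Occ (∷-injectiveʳ occ) i)

  Occurs⇒letter-≡ : ∀ {w i j} t → t < length w → Occurs w i → Occurs w j → u (i + t) ≡ u (j + t)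
  Occurs⇒letter-≡ t t<|w| occᵢ occⱼ = slice-≡-letter t t<|w| (trans occᵢ (sym occⱼ))

  Occurs-inner : ∀ {v w K K′} q → q + length w ≤ length v → Occurs v K → Occurs v K′
               → Occurs w (K + q) → Occurs w (K′ + q)
  Occurs-inner {w = w} q bound occ occ′ = trans (slice-≡-infix q (length w) bound (trans occ′ (sym occ)))

  IsFactor⇒Occurs : ∀ {w} → IsFactor u w → ∃ (Occurs w)
  IsFactor⇒Occurs (j , occ) = j , Occ⇒Occurs occ

  Occurs⇒IsFactor : ∀ {w j} → Occurs w j → IsFactor u w
  Occurs⇒IsFactor {j = j} occ = j , Occurs⇒Occ occ

  Occurs-∷⇔ : ∀ {a w j} → Occurs (a ∷ w) j ⇔ (u j ≡ a × Occurs w (suc j))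
  Occurs-∷⇔ = mk⇔ ∷-injective (λ (eq , occ) → cong₂ _∷_ eq occ)

  Occurs-∷ʳ⇔ : ∀ {w b j} → Occurs (w ∷ʳ b) j ⇔ (Occurs w j × u (j + length w) ≡ b)
  Occurs-∷ʳ⇔ {w} {b} {j} =
    mk⇔ (∷ʳ-injective _ w ∘ trans (sym slice-∷ʳ)) (λ (occ , eq) → trans slice-∷ʳ (cong₂ _∷ʳ_ occ eq))
    where
    slice-∷ʳ : slice u j (length (w ∷ʳ b)) ≡ slice u j (length w) ∷ʳ u (j + length w)
    slice-∷ʳ = trans (cong (slice u j) (length-++ w)) (slice-+ j (length w) 1)

  preceded⇒Occurs-∷⇔ : ∀ {a v} → (∀ i → Occurs v (suc i) → u i ≡ a)
                     → ∀ i → Occurs (a ∷ v) i ⇔ Occurs v (suc i)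
  preceded⇒Occurs-∷⇔ preceded i =
    mk⇔ (proj₂ ∘ to Occurs-∷⇔) (λ occ → from Occurs-∷⇔ (preceded i occ , occ))

  followed⇒Occurs-∷ʳ⇔ : ∀ {v b} → (∀ i → Occurs v i → u (i + length v) ≡ b)
                      → ∀ i → Occurs (v ∷ʳ b) i ⇔ Occurs v i
  followed⇒Occurs-∷ʳ⇔ followed i =
    mk⇔ (proj₁ ∘ to Occurs-∷ʳ⇔) (λ occ → from Occurs-∷ʳ⇔ (occ , followed i occ))

  Eℓ-at : ∀ {w j} → Occurs w (suc j) → Eℓ u w (u j)
  Eℓ-at occ = Occurs⇒IsFactor (from Occurs-∷⇔ (refl , occ))

  Er-at : ∀ {w j} → Occurs w j → Er u w (u (j + length w))
  Er-at occ = Occurs⇒IsFactor (from Occurs-∷ʳ⇔ (occ , refl))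

  letter-before-unique : ∀ {w i j} → ¬ LeftSpecial u w → Occurs w (suc i) → Occurs w (suc j)
                       → u i ≡ u j
  letter-before-unique ¬special occᵢ occⱼ =
    decidable-stable (_ Fin.≟ _) λ ne → ¬special (_ , _ , ne , Eℓ-at occᵢ , Eℓ-at occⱼ)

  letter-after-unique : ∀ {w i j} → ¬ RightSpecial u w → Occurs w i → Occurs w j
                      → u (i + length w) ≡ u (j + length w)
  letter-after-unique ¬special occᵢ occⱼ =
    decidable-stable (_ Fin.≟ _) λ ne → ¬special (_ , _ , ne , Er-at occᵢ , Er-at occⱼ)

  Returns : List (Fin k) → ℕ → ℕ → Set
  Returns w j L = 0 < L × Occurs w j × Occurs w (j + L) × (∀ t → 0 < t → t < L → ¬ Occurs w (j + t))

  ReturnWord : List (Fin k) → List (Fin k) → Set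
  ReturnWord w r = ∃₂ λ j L → Returns w j L × r ≡ slice u j L

  IsReturnWord⇔ReturnWord : ∀ {w r} → IsReturnWord u w r ⇔ ReturnWord w r
  IsReturnWord⇔ReturnWord {w} {r} = mk⇔ to′ from′
    where
    to′ : IsReturnWord u w r → ReturnWord w r
    to′ (j , _ , (j<l , occⱼ , occₗ , gap) , r≡) with m≤n⇒∃[o]m+o≡n j<l
    ... | L , refl = j , suc L , (s≤s z≤n , Occ⇒Occurs occⱼ , occ-next , gap′)
                   , trans r≡ (cong (slice u j) length≡)
      where
      occ-next : Occurs w (j + suc L)
      occ-next = subst (Occurs w) (sym (+-suc j L)) (Occ⇒Occurs occₗ)
      length≡ : suc j + L ∸ j ≡ suc L
      length≡ = trans (cong (_∸ j) (sym (+-suc j L))) (m+n∸m≡n j (suc L))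
      gap′ : ∀ t → 0 < t → t < suc L → ¬ Occurs w (j + t)
      gap′ t 0<t t<1+L occ =
        gap (j + t) (m<m+n j 0<t) (s≤s (+-monoʳ-≤ j (≤-pred t<1+L))) (Occurs⇒Occ occ)
    from′ : ReturnWord w r → IsReturnWord u w r
    from′ (j , L , (0<L , occⱼ , occₗ , gap) , r≡) =
      j , j + L , (m<m+n j 0<L , Occurs⇒Occ occⱼ , Occurs⇒Occ occₗ , gap′)
        , trans r≡ (cong (slice u j) (sym (m+n∸m≡n j L)))
      where
      gap′ : ∀ i → j < i → i < j + L → ¬ Occ u w i
      gap′ i j<i i<j+L occ with m≤n⇒∃[o]m+o≡n (<⇒≤ j<i)
      ... | t , refl = gap t 0<t (+-cancelˡ-< j t L i<j+L) (Occ⇒Occurs occ)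
        where
        0<t : 0 < t
        0<t = +-cancelˡ-< j 0 t (subst (_< j + t) (sym (+-identityʳ j)) j<i)

  slice-rotate : ∀ {a} j L → u j ≡ a → u (j + L) ≡ a → a ∷ slice u (suc j) L ≡ slice u j L ∷ʳ a
  slice-rotate {a} j L first last = begin
    a ∷ slice u (suc j) L          ≡⟨ cong (_∷ slice u (suc j) L) (sym first) ⟩
    slice u j (1 + L)              ≡⟨ cong (slice u j) (+-comm 1 L) ⟩
    slice u j (L + 1)              ≡⟨ slice-+ j L 1 ⟩
    slice u j L ∷ʳ u (j + L)       ≡⟨ cong (slice u j L ∷ʳ_) last ⟩
    slice u j L ∷ʳ a               ∎
    where open ≡-Reasoning

  Returns-cong : ∀ {v v′ j L} → (∀ i → Occurs v i ⇔ Occurs v′ i)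
               → Returns v j L → Returns v′ j L
  Returns-cong same (0<L , occⱼ , occₗ , gap) =
    0<L , to (same _) occⱼ , to (same _) occₗ , λ t 0<t t<L → gap t 0<t t<L ∘ from (same _)

  ReturnWord-cong : ∀ {v v′} → (∀ i → Occurs v i ⇔ Occurs v′ i)
                  → ∀ r → ReturnWord v r ⇔ ReturnWord v′ r
  ReturnWord-cong same r =
    mk⇔ (λ (j , L , ret , r≡) → j , L , Returns-cong same ret , r≡)
        (λ (j , L , ret , r≡) → j , L , Returns-cong (⇔-sym ∘ same) ret , r≡)

  Returns-shift : ∀ {v v′ j L} → (∀ i → Occurs v′ i ⇔ Occurs v (suc i))
                → Returns v′ j L ⇔ Returns v (suc j) L
  Returns-shift shift =
    mk⇔ (λ (0<L , occⱼ , occₗ , gap) →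
           0<L , to (shift _) occⱼ , to (shift _) occₗ , λ t 0<t t<L → gap t 0<t t<L ∘ from (shift _))
        (λ (0<L , occⱼ , occₗ , gap) →
           0<L , from (shift _) occⱼ , from (shift _) occₗ , λ t 0<t t<L → gap t 0<t t<L ∘ to (shift _))

  Returns-transport : ∀ {w i j L} → slice u i (L + length w) ≡ slice u j (L + length w)
                    → Returns w i L → Returns w j L
  Returns-transport {w} {i} {j} {L} window (0<L , occᵢ , occₗ , gap) =
    0<L , occⱼ , occⱼ₊ₗ ,
    λ t 0<t t<L → gap t 0<t t<L ∘ occurs-back t (+-monoˡ-≤ (length w) (<⇒≤ t<L))
    where
    occⱼ : Occurs w j
    occⱼ = trans (sym (slice-≡-prefix (length w) (m≤n+m _ L) window)) occᵢ
    occⱼ₊ₗ : Occurs w (j + L)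
    occⱼ₊ₗ = trans (sym (slice-≡-drop L window)) occₗ
    occurs-back : ∀ t → t + length w ≤ L + length w → Occurs w (j + t) → Occurs w (i + t)
    occurs-back t le = trans (slice-≡-infix t (length w) le window)

  slice-≡-extendʳ : ∀ {i i′ N} T
    → (∀ t → t < T → slice u (i + t) N ≡ slice u (i′ + t) N → u (i + t + N) ≡ u (i′ + t + N))
    → slice u i N ≡ slice u i′ N → slice u i (T + N) ≡ slice u i′ (T + N)
  slice-≡-extendʳ zero _ eq = eq
  slice-≡-extendʳ {i} {i′} {N} (suc T) next eq =
    subst (λ K → slice u i K ≡ slice u i′ K) (+-comm (T + N) 1)
      (slice-≡-++ (T + N) 1 agree (cong (_∷ []) last))
    where
    agree : slice u i (T + N) ≡ slice u i′ (T + N)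
    agree = slice-≡-extendʳ T (λ t t<T → next t (m<n⇒m<1+n t<T)) eq
    last : u (i + (T + N)) ≡ u (i′ + (T + N))
    last = subst₂ (λ p p′ → u p ≡ u p′) (+-assoc i T N) (+-assoc i′ T N)
             (next T ≤-refl (slice-≡-drop T agree))

  slice-≡-extendˡ : ∀ {N} T {i i′}
    → (∀ t → t < T → slice u (suc (i + t)) N ≡ slice u (suc (i′ + t)) N → u (i + t) ≡ u (i′ + t))
    → slice u (i + T) N ≡ slice u (i′ + T) N → slice u i (T + N) ≡ slice u i′ (T + N)
  slice-≡-extendˡ zero {i} {i′} _ eq rewrite +-identityʳ i | +-identityʳ i′ = eq
  slice-≡-extendˡ {N} (suc T) {i} {i′} prev eq = cong₂ _∷_ first rest
    where
    prev′ : ∀ t → t < T → slice u (suc (suc i + t)) N ≡ slice u (suc (suc i′ + t)) N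
          → u (suc i + t) ≡ u (suc i′ + t)
    prev′ t t<T rewrite sym (+-suc i t) | sym (+-suc i′ t) = prev (suc t) (s≤s t<T)
    rest : slice u (suc i) (T + N) ≡ slice u (suc i′) (T + N)
    rest = slice-≡-extendˡ T prev′
             (subst₂ (λ p p′ → slice u p N ≡ slice u p′ N) (+-suc i T) (+-suc i′ T) eq)
    first : u i ≡ u i′
    first with prev 0 (s≤s z≤n)
    ... | prev₀ rewrite +-identityʳ i | +-identityʳ i′ = prev₀ (slice-≡-prefix N (m≤n+m N T) rest)

  length-slice-injective : ∀ {j L j′ L′} → slice u j L ≡ slice u j′ L′ → L ≡ L′
  length-slice-injective {j} {L} {j′} {L′} eq =
    trans (sym (length-slice j L)) (trans (cong length eq) (length-slice j′ L′))

  Returns-window⇒≡ : ∀ {v j L j′ L′} → Returns v j L → Returns v j′ L′ → L ≤ L′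
    → slice u j (L + length v) ≡ slice u j′ (L + length v) → slice u j L ≡ slice u j′ L′
  Returns-window⇒≡ {L = L} (0<L , _ , occₗ , _) (_ , _ , _ , gap′) L≤L′ window
    with m≤n⇒m<n∨m≡n L≤L′
  ... | inj₁ L<L′ = ⊥-elim (gap′ L 0<L L<L′ (trans (sym (slice-≡-drop L window)) occₗ))
  ... | inj₂ refl = slice-≡-prefix L (m≤m+n L _) window

  ReturnWord-counted-by : ∀ {v m} {E : Fin k → Set} (letter : ℕ → ℕ → Fin k)
    → (∀ c → E c → ∃₂ λ j L → Returns v j L × letter j L ≡ c)
    → (∀ {j L} → Returns v j L → E (letter j L))
    → (∀ {j L j′ L′} → Returns v j L → Returns v j′ L′
         → slice u j L ≡ slice u j′ L′ → letter j L ≡ letter j′ L′)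
    → (∀ {j L j′ L′} → Returns v j L → Returns v j′ L′
         → letter j L ≡ letter j′ L′ → slice u j L ≡ slice u j′ L′)
    → HasCard E m → HasCard (ReturnWord v) m
  ReturnWord-counted-by {v} {E = E} letter realised extension word⇒letter letter⇒word =
    HasCard-map Labels image preimage functional injective
    where
    Labels : Fin k → List (Fin k) → Set
    Labels c r = ∃₂ λ j L → Returns v j L × r ≡ slice u j L × letter j L ≡ c

    image : ∀ c → E c → ∃ λ r → ReturnWord v r × Labels c r
    image c Ec with realised c Ec
    ... | j , L , ret , refl = slice u j L , (j , L , ret , refl) , (j , L , ret , refl , refl)

    preimage : ∀ r → ReturnWord v r → ∃ λ c → E c × Labels c r
    preimage r (j , L , ret , r≡) = letter j L , extension ret , (j , L , ret , r≡ , refl)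

    functional : ∀ {c r r′} → Labels c r → Labels c r′ → r ≡ r′
    functional (_ , _ , ret , refl , refl) (_ , _ , ret′ , refl , c≡) = letter⇒word ret ret′ (sym c≡)

    injective : ∀ {c c′ r} → Labels c r → Labels c′ r → c ≡ c′
    injective (_ , _ , ret , refl , refl) (_ , _ , ret′ , r≡ , refl) = word⇒letter ret ret′ r≡

  window-periodic : ∀ {v J d t} → Occurs v J → Occurs v (J + d) → t < length v
                  → u (J + t) ≡ u (J + t + d)
  window-periodic {J = J} {d} {t} occ occ′ t<|v| =
    trans (Occurs⇒letter-≡ t t<|v| occ occ′) (cong u (xy∙z≈xz∙y J d t))

  periodic-forward : ∀ {v d} → 0 < d → d ≤ length v → (∀ {J} → Occurs v J → Occurs v (J + d))
                   → ∀ {J} → Occurs v J → ∀ x → J ≤ x → u x ≡ u (x + d)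
  periodic-forward {v} {d} 0<d d≤|v| step occ x J≤x with m≤n⇒∃[o]m+o≡n J≤x
  ... | t , refl = <-rec (λ t → ∀ {J} → Occurs v J → u (J + t) ≡ u (J + t + d)) go t occ
    where
    go : ∀ t → (∀ {t′} → t′ < t → ∀ {J} → Occurs v J → u (J + t′) ≡ u (J + t′ + d))
       → ∀ {J} → Occurs v J → u (J + t) ≡ u (J + t + d)
    go t earlier {J} occ with t <? d
    ... | yes t<d = window-periodic occ (step occ) (<-≤-trans t<d d≤|v|)
    ... | no t≮d with t ∸ d | m∸n+n≡m (≮⇒≥ t≮d)
    ...   | t′ | refl = subst (λ x → u x ≡ u (x + d)) (trans (xy∙z≈xz∙y J d t′) (+-assoc J t′ d))
                          (earlier (m<m+n t′ 0<d) (step occ))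

  module _ (rec : Recurrent u) where

    occurs-beyond : ∀ {w j} → Occurs w j → ∀ M → ∃ λ j′ → M ≤ j′ × Occurs w j′
    occurs-beyond {w} occ M with rec w (Occurs⇒IsFactor occ) M
    ... | j′ , M≤j′ , occ′ = j′ , M≤j′ , Occ⇒Occurs occ′

    returns-from : ∀ {w j} → Occurs w j → ∃ (Returns w j)
    returns-from {w} {j} occⱼ with occurs-beyond occⱼ (suc j)
    ... | j′ , j<j′ , occⱼ′ with m≤n⇒∃[o]m+o≡n j<j′
    ...   | t , refl with least-witness later? (s≤s z≤n , subst (Occurs w) (sym (+-suc j t)) occⱼ′)
      where
      later? : ∀ t → Dec (0 < t × Occurs w (j + t))
      later? t = (0 <? t) ×-dec Occurs? w (j + t)
    ... | L , (0<L , occₗ) , earlier =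
      L , 0<L , occⱼ , occₗ , λ t 0<t t<L occ → earlier t t<L (0<t , occ)

    Returns-beyond : ∀ {w j L} → Returns w j L
                   → ∀ M → ∃ λ J → M ≤ J × Returns w J L × slice u j L ≡ slice u J L
    Returns-beyond {w} {j} {L} ret M with occurs-beyond (Occurs-slice j (L + length w)) M
    ... | J , M≤J , occ = J , M≤J , Returns-transport window ret , slice-≡-prefix L (m≤m+n L _) window
      where
      window : slice u j (L + length w) ≡ slice u J (L + length w)
      window = Occurs-slice⇒≡ occ

    ReturnWord-∷ : ∀ {a v m} → (∀ i → Occurs (a ∷ v) i ⇔ Occurs v (suc i))
                 → HasCard (ReturnWord (a ∷ v)) m → HasCard (ReturnWord v) m
    ReturnWord-∷ {a} {v} shift = HasCard-map (λ r r′ → a ∷ r′ ≡ r ∷ʳ a) image preimage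
      (λ rot rot′ → ∷-injectiveʳ (trans rot (sym rot′)))
      (λ rot rot′ → ∷ʳ-injectiveˡ _ _ (trans (sym rot) rot′))
      where
      rotate : ∀ {i L} → Returns (a ∷ v) i L → a ∷ slice u (suc i) L ≡ slice u i L ∷ʳ a
      rotate {i} {L} (_ , occᵢ , occₗ , _) =
        slice-rotate i L (proj₁ (to Occurs-∷⇔ occᵢ)) (proj₁ (to Occurs-∷⇔ occₗ))

      image : ∀ r → ReturnWord (a ∷ v) r → ∃ λ r′ → ReturnWord v r′ × a ∷ r′ ≡ r ∷ʳ a
      image _ (i , L , ret , refl) =
        slice u (suc i) L , (suc i , L , to (Returns-shift shift) ret , refl) , rotate ret

      preimage : ∀ r′ → ReturnWord v r′ → ∃ λ r → ReturnWord (a ∷ v) r × a ∷ r′ ≡ r ∷ʳ a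
      preimage _ (_ , L , ret′ , refl) with Returns-beyond ret′ 1
      ... | suc i , _ , ret , r′≡ =
        slice u i L , (i , L , ret₀ , refl) , trans (cong (a ∷_) r′≡) (rotate ret₀)
        where
        ret₀ : Returns (a ∷ v) i L
        ret₀ = from (Returns-shift shift) ret

    module _ {v : List (Fin k)}
             (unique : ∀ x → length x ≡ length v → IsFactor u x → RightSpecial u x → x ≡ v) where

      private
        N : ℕ
        N = length v

      next-letter-forced : ∀ {p p′} → ¬ Occurs v p → slice u p N ≡ slice u p′ N
                         → u (p + N) ≡ u (p′ + N)
      next-letter-forced {p} {p′} ¬occ eq = subst (λ n → u (p + n) ≡ u (p′ + n)) (length-slice p N)
        (letter-after-unique ¬special (Occurs-slice p N) (slice-≡⇒Occurs eq))
        where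
        ¬special : ¬ RightSpecial u (slice u p N)
        ¬special special = ¬occ (unique _ (length-slice p N) (Occurs⇒IsFactor (Occurs-slice p N)) special)

      Returns-agree-rightwards : ∀ {j L j′ L′} → Returns v j L → Returns v j′ L′
        → u (j + N) ≡ u (j′ + N) → slice u j (L + N) ≡ slice u j′ (L + N)
      Returns-agree-rightwards {j} {L} {j′} (_ , occⱼ , _ , gap) (_ , occⱼ′ , _ , _) first =
        slice-≡-extendʳ L next (trans occⱼ (sym occⱼ′))
        where
        next : ∀ t → t < L → slice u (j + t) N ≡ slice u (j′ + t) N → u (j + t + N) ≡ u (j′ + t + N)
        next zero _ _ rewrite +-identityʳ j | +-identityʳ j′ = first
        next (suc t) t<L = next-letter-forced (gap (suc t) (s≤s z≤n) t<L)

      Returns-determined-by-next-letter : ∀ {j L j′ L′} → Returns v j L → Returns v j′ L′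
        → u (j + N) ≡ u (j′ + N) → slice u j L ≡ slice u j′ L′
      Returns-determined-by-next-letter {L = L} {L′ = L′} ret ret′ first with ≤-total L L′
      ... | inj₁ L≤L′ = Returns-window⇒≡ ret ret′ L≤L′ (Returns-agree-rightwards ret ret′ first)
      ... | inj₂ L′≤L =
        sym (Returns-window⇒≡ ret′ ret L′≤L (Returns-agree-rightwards ret′ ret (sym first)))

      ReturnWord-card-right-special : ∀ {m} → HasCard (Er u v) m → HasCard (ReturnWord v) m
      ReturnWord-card-right-special = ReturnWord-counted-by (λ j _ → u (j + N))
        realised (λ (_ , occⱼ , _) → Er-at occⱼ) word⇒letter Returns-determined-by-next-letter
        where
        realised : ∀ b → Er u v b → ∃₂ λ j L → Returns v j L × u (j + N) ≡ b
        realised b vb with IsFactor⇒Occurs vb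
        ... | j , occ with to Occurs-∷ʳ⇔ occ
        ... | occⱼ , followed with returns-from occⱼ
        ... | L , ret = j , L , ret , followed

        word⇒letter : ∀ {j L j′ L′} → Returns v j L → Returns v j′ L′
                    → slice u j L ≡ slice u j′ L′ → u (j + N) ≡ u (j′ + N)
        word⇒letter {L = L} (0<L , _ , occₗ , _) (_ , _ , occₗ′ , _) eq with length-slice-injective eq
        ... | refl = slice-≡-letter N (m<n+m N 0<L) (slice-≡-++ L N eq (trans occₗ (sym occₗ′)))

    module _ {v : List (Fin k)}
             (unique : ∀ x → length x ≡ length v → IsFactor u x → LeftSpecial u x → x ≡ v) where

      private
        N : ℕ
        N = length v

      previous-letter-forced : ∀ {p p′} → ¬ Occurs v (suc p) → slice u (suc p) N ≡ slice u (suc p′) N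
                             → u p ≡ u p′
      previous-letter-forced {p} ¬occ eq =
        letter-before-unique ¬special (Occurs-slice (suc p) N) (slice-≡⇒Occurs eq)
        where
        ¬special : ¬ LeftSpecial u (slice u (suc p) N)
        ¬special special =
          ¬occ (unique _ (length-slice (suc p) N) (Occurs⇒IsFactor (Occurs-slice (suc p) N)) special)

      Returns-agree-leftwards : ∀ {j L j′} → Returns v j L → Occurs v (j′ + L)
        → u (j + pred L) ≡ u (j′ + pred L) → slice u j (L + N) ≡ slice u j′ (L + N)
      Returns-agree-leftwards {j} {suc L₀} {j′} (_ , _ , occₗ , gap) occ′ last =
        slice-≡-extendˡ (suc L₀) previous (trans occₗ (sym occ′))
        where
        previous : ∀ t → t < suc L₀ → slice u (suc (j + t)) N ≡ slice u (suc (j′ + t)) N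
                 → u (j + t) ≡ u (j′ + t)
        previous t (s≤s t≤L₀) with m≤n⇒m<n∨m≡n t≤L₀
        ... | inj₂ refl = λ _ → last
        ... | inj₁ t<L₀ =
          previous-letter-forced (gap (suc t) (s≤s z≤n) (s≤s t<L₀) ∘ subst (Occurs v) (sym (+-suc j t)))

      Returns-determined-by-previous-letter-≤ : ∀ {j L j′ L′} → Returns v j L → Returns v j′ L′ → L ≤ L′
        → u (j + pred L) ≡ u (j′ + pred L′) → slice u j L ≡ slice u j′ L′
      Returns-determined-by-previous-letter-≤ {L = L} {L′ = L′} ret ret′ L≤L′ last
        with L′ ∸ L | m∸n+n≡m L≤L′
      Returns-determined-by-previous-letter-≤ {L = L} ret (_ , _ , occₗ′ , _) _ last | zero | refl =
        slice-≡-prefix L (m≤m+n L N) (Returns-agree-leftwards ret occₗ′ last)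
      Returns-determined-by-previous-letter-≤ {j} {suc L₀} {j′} ret@(_ , occⱼ , _) (_ , _ , occₗ′ , gap′) _
        last | suc δ | refl = ⊥-elim (gap′ (suc δ) (s≤s z≤n) (m<m+n (suc δ) (s≤s z≤n)) inner-occurrence)
        where
        aligned-end : Occurs v (j′ + suc δ + suc L₀)
        aligned-end = subst (Occurs v) (sym (+-assoc j′ (suc δ) (suc L₀))) occₗ′
        aligned-last : u (j + L₀) ≡ u (j′ + suc δ + L₀)
        aligned-last = trans last (cong u (trans (cong (j′ +_) (+-suc δ L₀)) (sym (+-assoc j′ (suc δ) L₀))))
        window : slice u j (suc L₀ + N) ≡ slice u (j′ + suc δ) (suc L₀ + N)
        window = Returns-agree-leftwards ret aligned-end aligned-last
        inner-occurrence : Occurs v (j′ + suc δ)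
        inner-occurrence = trans (sym (slice-≡-prefix N (m≤n+m N (suc L₀)) window)) occⱼ

      Returns-determined-by-previous-letter : ∀ {j L j′ L′} → Returns v j L → Returns v j′ L′
        → u (j + pred L) ≡ u (j′ + pred L′) → slice u j L ≡ slice u j′ L′
      Returns-determined-by-previous-letter {L = L} {L′ = L′} ret ret′ last with ≤-total L L′
      ... | inj₁ L≤L′ = Returns-determined-by-previous-letter-≤ ret ret′ L≤L′ last
      ... | inj₂ L′≤L = sym (Returns-determined-by-previous-letter-≤ ret′ ret L′≤L (sym last))

      ReturnWord-card-left-special : ∀ {m} → HasCard (Eℓ u v) m → HasCard (ReturnWord v) m
      ReturnWord-card-left-special = ReturnWord-counted-by (λ j L → u (j + pred L))
        realised extension word⇒letter Returns-determined-by-previous-letter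
        where
        realised : ∀ a → Eℓ u v a → ∃₂ λ j L → Returns v j L × u (j + pred L) ≡ a
        realised a av with IsFactor⇒Occurs av
        ... | q , occ with occurs-beyond occ (suc q)
        ... | q′ , q<q′ , occ′ with to Occurs-∷⇔ occ | to Occurs-∷⇔ occ′
        ... | _ , occ-v | preceded , occ-v′ with last-before (Occurs? v) occ-v (suc q′) (s≤s q<q′)
        ... | l , _ , l<q′+1 , occₗ , gap with m≤n⇒∃[o]m+o≡n (≤-pred l<q′+1)
        ... | L₀ , refl = l , suc L₀ , (s≤s z≤n , occₗ , occ-next , gap′) , preceded
          where
          occ-next : Occurs v (l + suc L₀)
          occ-next = subst (Occurs v) (sym (+-suc l L₀)) occ-v′
          gap′ : ∀ t → 0 < t → t < suc L₀ → ¬ Occurs v (l + t)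
          gap′ t 0<t t<L = gap (l + t) (m<m+n l 0<t) (s≤s (+-monoʳ-≤ l (≤-pred t<L)))

        extension : ∀ {j L} → Returns v j L → Eℓ u v (u (j + pred L))
        extension {j} {suc L₀} (_ , _ , occₗ , _) = Eℓ-at (subst (Occurs v) (+-suc j L₀) occₗ)

        word⇒letter : ∀ {j L j′ L′} → Returns v j L → Returns v j′ L′
                    → slice u j L ≡ slice u j′ L′ → u (j + pred L) ≡ u (j′ + pred L′)
        word⇒letter {L = suc L₀} _ _ eq with length-slice-injective eq
        ... | refl = slice-≡-letter L₀ ≤-refl eq

    periodic⇒¬LeftSpecial : ∀ {c d s} → (∀ x → c ≤ x → u x ≡ u (x + suc d)) → length s ≡ suc d
                          → ¬ LeftSpecial u s
    periodic⇒¬LeftSpecial {c} {d} periodic |s| (a , b , a≢b , as , bs)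
      with occurs-beyond (proj₂ (IsFactor⇒Occurs as)) c | occurs-beyond (proj₂ (IsFactor⇒Occurs bs)) c
    ... | J , c≤J , occ | J′ , c≤J′ , occ′ with to Occurs-∷⇔ occ | to Occurs-∷⇔ occ′
    ... | refl , occ-s | refl , occ-s′ = a≢b (begin
      u J              ≡⟨ periodic J c≤J ⟩
      u (J + suc d)    ≡⟨ cong u (+-suc J d) ⟩
      u (suc J + d)    ≡⟨ Occurs⇒letter-≡ d (subst (d <_) (sym |s|) ≤-refl) occ-s occ-s′ ⟩
      u (suc J′ + d)   ≡⟨ cong u (sym (+-suc J′ d)) ⟩
      u (J′ + suc d)   ≡⟨ sym (periodic J′ c≤J′) ⟩
      u J′             ∎)
      where open ≡-Reasoning

    periodic⇒¬RightSpecial : ∀ {c d s} → (∀ x → c ≤ x → u x ≡ u (x + suc d)) → length s ≡ suc d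
                           → ¬ RightSpecial u s
    periodic⇒¬RightSpecial {c} {d} {s} periodic |s| (a , b , a≢b , sa , sb)
      with occurs-beyond (proj₂ (IsFactor⇒Occurs sa)) c | occurs-beyond (proj₂ (IsFactor⇒Occurs sb)) c
    ... | J , c≤J , occ | J′ , c≤J′ , occ′
      with to (Occurs-∷ʳ⇔ {s} {a}) occ | to (Occurs-∷ʳ⇔ {s} {b}) occ′
    ... | occ-s , refl | occ-s′ , refl = a≢b (begin
      u (J + length s)    ≡⟨ cong (λ n → u (J + n)) |s| ⟩
      u (J + suc d)       ≡⟨ sym (periodic J c≤J) ⟩
      u J                 ≡⟨ cong u (sym (+-identityʳ J)) ⟩
      u (J + 0)           ≡⟨ Occurs⇒letter-≡ 0 (subst (0 <_) (sym |s|) (s≤s z≤n)) occ-s occ-s′ ⟩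
      u (J′ + 0)          ≡⟨ cong u (+-identityʳ J′) ⟩
      u J′                ≡⟨ periodic J′ c≤J′ ⟩
      u (J′ + suc d)      ≡⟨ cong (λ n → u (J′ + n)) (sym |s|) ⟩
      u (J′ + length s)   ∎)
      where open ≡-Reasoning

    periodic-backward : ∀ {v d} → 0 < d → d < length v → (∀ {J} → Occurs v (J + d) → Occurs v J)
                      → ∀ {K} → Occurs v K → ∀ x → d ≤ x → u x ≡ u (x + d)
    periodic-backward {v} {d} 0<d d<|v| step occ x d≤x with occurs-beyond occ x
    ... | K , x≤K , occ-K = <-rec (λ K → Occurs v K → x ≤ K → u x ≡ u (x + d)) go K occ-K x≤K
      where
      go : ∀ K → (∀ {K′} → K′ < K → Occurs v K′ → x ≤ K′ → u x ≡ u (x + d))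
         → Occurs v K → x ≤ K → u x ≡ u (x + d)
      go K earlier occ x≤K with K ∸ d | m∸n+n≡m (≤-trans d≤x x≤K)
      ... | K′ | refl with K′ ≤? x
      ...   | no K′≰x = earlier (m<m+n K′ 0<d) (step occ) (<⇒≤ (≰⇒> K′≰x))
      ...   | yes K′≤x with m≤n⇒∃[o]m+o≡n K′≤x
      ...     | t , refl = window-periodic (step occ) occ (≤-<-trans (+-cancelˡ-≤ K′ t d x≤K) d<|v|)

    module _ {m} (hyp : ∀ n → CondLeft u m n ⊎ CondRight u m n) where

      not-eventually-periodic : ∀ {c d} → 0 < d → ¬ (∀ x → c ≤ x → u x ≡ u (x + d))
      not-eventually-periodic {d = suc d} _ periodic with hyp (suc d)
      ... | inj₁ (s , |s| , _ , special , _) = periodic⇒¬LeftSpecial {s = s} periodic |s| special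
      ... | inj₂ (s , |s| , _ , special , _) = periodic⇒¬RightSpecial {s = s} periodic |s| special

      module _ (w : List (Fin k)) {d} (0<d : 0 < d)
               (recurs : ∀ M → ∃ λ j → M ≤ j × Occurs w j × Occurs w (j + d)) where

        ForcedExtension : List (Fin k) → ℕ → Set
        ForcedExtension v p = ∀ i → Occurs v i ⇔ Occurs w (i + p)

        ForcedExtension-refl : ForcedExtension w 0
        ForcedExtension-refl i =
          mk⇔ (subst (Occurs w) (sym (+-identityʳ i))) (subst (Occurs w) (+-identityʳ i))

        ForcedExtension-recurs : ∀ {v p} → ForcedExtension v p → ∃ λ I → Occurs v I × Occurs v (I + d)
        ForcedExtension-recurs {p = p} forced with recurs p
        ... | j , p≤j , occ , occ′ with j ∸ p | m∸n+n≡m p≤j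
        ... | I | refl =
          I , from (forced I) occ , from (forced (I + d)) (subst (Occurs w) (xy∙z≈xz∙y I p d) occ′)

        ForcedExtension-step-forward : ∀ {v p I} → ForcedExtension v p → Occurs v I → Occurs v (I + d)
          → d + p + length w ≤ length v → ∀ {J} → Occurs v J → Occurs v (J + d)
        ForcedExtension-step-forward {p = p} {I} forced occ occ′ bound {J} occ-J =
          from (forced (J + d)) (subst (Occurs w) (sym (+-assoc J d p))
            (Occurs-inner (d + p) bound occ occ-J w-inside))
          where
          w-inside : Occurs w (I + (d + p))
          w-inside = subst (Occurs w) (+-assoc I d p) (to (forced (I + d)) occ′)

        ForcedExtension-step-backward : ∀ {v p I} → ForcedExtension v (p + d) → Occurs v I → Occurs v (I + d)
          → p + length w ≤ length v → ∀ {J} → Occurs v (J + d) → Occurs v J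
        ForcedExtension-step-backward {p = p} {I} forced occ occ′ bound {J} occ-J+d =
          from (forced J) (subst (Occurs w) (shift J) (Occurs-inner p bound occ′ occ-J+d w-inside))
          where
          shift : ∀ i → i + d + p ≡ i + (p + d)
          shift i = trans (xy∙z≈xz∙y i d p) (+-assoc i p d)
          w-inside : Occurs w (I + d + p)
          w-inside = subst (Occurs w) (sym (shift I)) (to (forced I) occ)

        ForcedExtension-bounded : ∀ {v p} → ForcedExtension v p → p + length w ≤ length v
                                → length w + (d + d) ≰ length v
        ForcedExtension-bounded {v} {p} forced inside long with ForcedExtension-recurs forced | d ≤? p
        ... | _ , occ , occ′ | yes d≤p with p ∸ d | m∸n+n≡m d≤p
        ...   | p′ | refl = not-eventually-periodic 0<d (periodic-backward 0<d d<|v| step occ)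
          where
          d<|v| : d < length v
          d<|v| = <-≤-trans (m<m+n d 0<d) (≤-trans (m≤n+m (d + d) (length w)) long)
          step : ∀ {J} → Occurs v (J + d) → Occurs v J
          step = ForcedExtension-step-backward forced occ occ′
                   (≤-trans (+-monoˡ-≤ (length w) (m≤m+n p′ d)) inside)
        ForcedExtension-bounded {v} {p} forced inside long | _ , occ , occ′ | no d≰p =
          not-eventually-periodic 0<d (periodic-forward 0<d d≤|v| step occ)
          where
          d≤|v| : d ≤ length v
          d≤|v| = ≤-trans (m≤m+n d d) (≤-trans (m≤n+m (d + d) (length w)) long)
          bound : d + p + length w ≤ length v
          bound = ≤-trans (≤-reflexive (+-comm (d + p) (length w)))
                    (≤-trans (+-monoʳ-≤ (length w) (+-monoʳ-≤ d (<⇒≤ (≰⇒> d≰p)))) long)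
          step : ∀ {J} → Occurs v J → Occurs v (J + d)
          step = ForcedExtension-step-forward forced occ occ′ bound

        ForcedExtension-right : ∀ {v p} → ForcedExtension v p → ¬ RightSpecial u v
          → ∃ λ b → ForcedExtension (v ∷ʳ b) p × (∀ i → Occurs (v ∷ʳ b) i ⇔ Occurs v i)
        ForcedExtension-right {v} forced ¬special with ForcedExtension-recurs forced
        ... | I , occ , _ = u (I + length v) , (λ i → ⇔-trans (continue i) (forced i)) , continue
          where
          continue : ∀ i → Occurs (v ∷ʳ u (I + length v)) i ⇔ Occurs v i
          continue = followed⇒Occurs-∷ʳ⇔ (λ i occ-i → letter-after-unique ¬special occ-i occ)

        ForcedExtension-left : ∀ {v p} → ForcedExtension v p → ¬ LeftSpecial u v
          → ∃ λ a → ForcedExtension (a ∷ v) (suc p) × (∀ i → Occurs (a ∷ v) i ⇔ Occurs v (suc i))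
        ForcedExtension-left {v} {p} forced ¬special with ForcedExtension-recurs forced
        ... | _ , occ , _ with occurs-beyond occ 1
        ... | suc i , _ , occ-i = u i , forced′ , shift
          where
          shift : ∀ i′ → Occurs (u i ∷ v) i′ ⇔ Occurs v (suc i′)
          shift = preceded⇒Occurs-∷⇔ (λ i′ occ-i′ → letter-before-unique ¬special occ-i′ occ-i)
          forced′ : ForcedExtension (u i ∷ v) (suc p)
          forced′ i′ = subst (λ x → Occurs (u i ∷ v) i′ ⇔ Occurs w x) (sym (+-suc i′ p))
                         (⇔-trans (shift i′) (forced (suc i′)))

        fuel-step : ∀ {K f n n′} → K ≤ suc f + n → n′ ≡ suc n → K ≤ f + n′
        fuel-step {K} {f} {n} le refl = subst (K ≤_) (sym (+-suc f n)) le

        extend : ∀ f {v p} → ForcedExtension v p → p + length w ≤ length v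
               → length w + (d + d) ≤ f + length v → HasCard (ReturnWord v) m
        extend zero forced inside long = ⊥-elim (ForcedExtension-bounded forced inside long)
        extend (suc f) {v} {p} forced inside long with hyp (length v) | ForcedExtension-recurs forced
        ... | inj₁ (s , _ , _ , _ , unique , card) | _ , occ , _ with ≡-dec Fin._≟_ v s
        ...   | yes refl = ReturnWord-card-left-special unique card
        ...   | no v≢s with ForcedExtension-left forced (v≢s ∘ unique v refl (Occurs⇒IsFactor occ))
        ...     | _ , forced′ , shift = ReturnWord-∷ shift (extend f forced′ (s≤s inside) (fuel-step long refl))
        extend (suc f) {v} {p} forced inside long | inj₂ (s , _ , _ , _ , unique , card) | _ , occ , _
          with ≡-dec Fin._≟_ v s
        ...   | yes refl = ReturnWord-card-right-special unique card
        ...   | no v≢s with ForcedExtension-right forced (v≢s ∘ unique v refl (Occurs⇒IsFactor occ))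
        ...     | b , forced′ , continue = HasCard-cong (ReturnWord-cong continue)
                    (extend f forced′ (subst (p + length w ≤_) (sym (length-∷ʳ v b)) (m≤n⇒m≤1+n inside))
                      (fuel-step long (length-∷ʳ v b)))

      ReturnWord-card : ∀ w → IsFactor u w → HasCard (ReturnWord w) m
      ReturnWord-card w w-factor with IsFactor⇒Occurs w-factor
      ... | _ , occ with returns-from occ
      ... | d , ret@(0<d , _) =
        extend w 0<d recurs (length w + (d + d)) (ForcedExtension-refl w 0<d recurs) ≤-refl
          (m≤m+n _ (length w))
        where
        recurs : ∀ M → ∃ λ J → M ≤ J × Occurs w J × Occurs w (J + d)
        recurs M with Returns-beyond ret M
        ... | J , M≤J , (_ , occ-J , occ-J+d , _) , _ = J , M≤J , occ-J , occ-J+d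

proposition3p1 : ∀ {k : ℕ} (u : Word k) (m : ℕ) → Recurrent u
    → (∀ (n : ℕ) → CondLeft u m n ⊎ CondRight u m n)
    → PropertyR u m
proposition3p1 u m rec hyp w w-factor =
  HasCard-cong (λ _ → ⇔-sym (IsReturnWord⇔ReturnWord u)) (ReturnWord-card u rec hyp w w-factor)
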